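{- For any finite simple connected graph $G$ with $|V(G)|\geq 3$ and any cycle $C_n$, $\gamma_{P,c}(G\,\square\,C_n)\leq 2\gamma_c(G)$.
   Context: Power domination: for $S\subseteq V(G)$, start with $M(S)=N[S]$ and repeatedly add a vertex $w$ whenever some $v\in M(S)$ has $w$ as its unique neighbour outside $M(S)$; $S$ is a connected power dominating set if the final $M(S)$ is the whole vertex set and $\langle S\rangle$ is connected; $\gamma_{P,c}$ denotes the minimum size of such a set. $\gamma_c(G)$ is the connected domination number. The Cartesian product $G\,\square\,H$ has vertex set $V(G)\times V(H)$, with $(a,b)\sim(x,y)$ iff either $a=x$ and $by\in E(H)$, or $b=y$ and $ax\in E(G)$. $C_n$ is the cycle on $n$ vertices. -}

module Defs where

open import Data.Nat using (ℕ; zero; suc; _*_; _∸_; _≤_)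
open import Data.Fin using (Fin; toℕ; combine)
open import Data.Fin.Subset using (Subset; _∈_; ∣_∣; ⊤)
open import Data.Product using (∃; _×_)
open import Data.Sum using (_⊎_)
open import Relation.Binary.PropositionalEquality using (_≡_; _≢_)
open import Relation.Nullary using (¬_)

data WalkIn {N : ℕ} (Adj : Fin N → Fin N → Set) (S : Subset N) : Fin N → Fin N → Set where
  here : ∀ {u} → u ∈ S → WalkIn Adj S u u
  step : ∀ {u v w} → u ∈ S → Adj u v → WalkIn Adj S v w → WalkIn Adj S u w

InducedConnected : {N : ℕ} → (Fin N → Fin N → Set) → Subset N → Set
InducedConnected {N} Adj S = ∀ (u v : Fin N) → u ∈ S → v ∈ S → WalkIn Adj S u v

Connected : {N : ℕ} → (Fin N → Fin N → Set) → Set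
Connected Adj = InducedConnected Adj ⊤

Dominating : {N : ℕ} → (Fin N → Fin N → Set) → Subset N → Set
Dominating {N} Adj S = ∀ (v : Fin N) → v ∈ S ⊎ ∃ λ u → u ∈ S × Adj u v

IsConnectedDominating : {N : ℕ} → (Fin N → Fin N → Set) → Subset N → Set
IsConnectedDominating Adj S = Dominating Adj S × InducedConnected Adj S

-- Power domination: Observed Adj S v  means  v ∈ M(S), the final monitored set.
data Observed {N : ℕ} (Adj : Fin N → Fin N → Set) (S : Subset N) : Fin N → Set where
  self  : ∀ {v} → v ∈ S → Observed Adj S v
  nbr   : ∀ {u v} → u ∈ S → Adj u v → Observed Adj S v
  force : ∀ {v w} → Observed Adj S v → Adj v w →
          (∀ x → Adj v x → x ≢ w → Observed Adj S x) → Observed Adj S w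

IsPowerDominating : {N : ℕ} → (Fin N → Fin N → Set) → Subset N → Set
IsPowerDominating {N} Adj S = ∀ (v : Fin N) → Observed Adj S v

IsConnectedPowerDominating : {N : ℕ} → (Fin N → Fin N → Set) → Subset N → Set
IsConnectedPowerDominating Adj S = IsPowerDominating Adj S × InducedConnected Adj S

IsMinimum : {N : ℕ} → (Subset N → Set) → ℕ → Set
IsMinimum {N} P k = (∃ λ S → P S × ∣ S ∣ ≡ k) × (∀ S → P S → k ≤ ∣ S ∣)

ConnDomNumber : {N : ℕ} → (Fin N → Fin N → Set) → ℕ → Set
ConnDomNumber Adj = IsMinimum (IsConnectedDominating Adj)

ConnPowerDomNumber : {N : ℕ} → (Fin N → Fin N → Set) → ℕ → Set
ConnPowerDomNumber Adj = IsMinimum (IsConnectedPowerDominating Adj)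

record IsSimple {N : ℕ} (Adj : Fin N → Fin N → Set) : Set where
  field
    sym   : ∀ {u v} → Adj u v → Adj v u
    irref : ∀ {u} → ¬ Adj u u

SuccMod : (m : ℕ) → Fin m → Fin m → Set
SuccMod m i j = toℕ j ≡ suc (toℕ i) ⊎ (toℕ i ≡ m ∸ 1 × toℕ j ≡ zero)

CycleAdj : (m : ℕ) → Fin m → Fin m → Set
CycleAdj m i j = SuccMod m i j ⊎ SuccMod m j i

BoxAdj : {N M : ℕ} → (Fin N → Fin N → Set) → (Fin M → Fin M → Set) →
         Fin (N * M) → Fin (N * M) → Set
BoxAdj {N} {M} AG AH p q =
  ∃ λ (a : Fin N) → ∃ λ (b : Fin M) → ∃ λ (x : Fin N) → ∃ λ (y : Fin M) →
    p ≡ combine a b × q ≡ combine x y ×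
    ((a ≡ x × AH b y) ⊎ (b ≡ y × AG a x))

{-# OPTIONS --safe #-}
-- If S is a connected dominating set of G, then S × {0, 1} is a connected power
-- dominating set of G □ Cₘ of size 2|S|.  Domination by S observes the two layers
-- G × {0} and G × {1}; afterwards, for 1 ≤ c, every vertex (v, c) has (v, c + 1) as
-- its only neighbour outside the layers 0, …, c, so layer c + 1 is forced, and the
-- whole product is observed layer by layer.
module Submission where

open import Defs
open import Data.Nat using (ℕ; _*_; _≤_; zero; suc; _+_; _<_; z≤n; s≤s; s≤s⁻¹)
open import Data.Nat.Properties using (≤-reflexive; ≤-trans; n≤1+n; <⇒≤; m≤n⇒m<n∨m≡n; *-comm)
open import Data.Fin using (Fin; zero; suc; toℕ; fromℕ<; combine; remQuot; _↑ˡ_; _↑ʳ_)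
open import Data.Fin.Properties using (toℕ-injective; toℕ-fromℕ<; toℕ<n; combine-remQuot; combine-injective)
open import Data.Fin.Subset using (Subset; inside; outside; _∈_; ∣_∣; ⊥)
open import Data.Fin.Subset.Properties using (∉⊥; ∣⊥∣≡0)
open import Data.Bool using (Bool)
open import Data.Vec using (Vec; []; _∷_; _++_; _[_]=_; here; there)
open import Data.Vec.Properties using (lookup-++ˡ; lookup-++ʳ; []=⇒lookup; lookup⇒[]=)
open import Data.Product using (_,_; _×_; uncurry; map₁)
open import Data.Sum using (inj₁; inj₂; _⊎_)
open import Relation.Binary.PropositionalEquality
  using (_≡_; _≢_; refl; sym; trans; cong; cong₂; subst)
open import Relation.Nullary using (contradiction)

private
  variable
    n m : ℕ

∀-combine : {P : Fin (n * m) → Set} → (∀ a b → P (combine a b)) → ∀ p → P p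
∀-combine {n} {m} {P} P-combine p = subst P (combine-remQuot {n} m p) (uncurry P-combine (remQuot {n} m p))

module _ {A : Set} {x : A} (xs : Vec A n) (ys : Vec A m) where
  []=-++⁺ˡ : ∀ {i} → xs [ i ]= x → (xs ++ ys) [ i ↑ˡ m ]= x
  []=-++⁺ˡ {i} xs[i]=x = lookup⇒[]= _ (xs ++ ys) (trans (lookup-++ˡ xs ys i) ([]=⇒lookup xs[i]=x))

  []=-++⁺ʳ : ∀ {i} → ys [ i ]= x → (xs ++ ys) [ n ↑ʳ i ]= x
  []=-++⁺ʳ {i} ys[i]=x = lookup⇒[]= _ (xs ++ ys) (trans (lookup-++ʳ xs ys i) ([]=⇒lookup ys[i]=x))

  []=-++⁻ˡ : ∀ {i} → (xs ++ ys) [ i ↑ˡ m ]= x → xs [ i ]= x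
  []=-++⁻ˡ {i} h = lookup⇒[]= i xs (trans (sym (lookup-++ˡ xs ys i)) ([]=⇒lookup h))

  []=-++⁻ʳ : ∀ {i} → (xs ++ ys) [ n ↑ʳ i ]= x → ys [ i ]= x
  []=-++⁻ʳ {i} h = lookup⇒[]= i ys (trans (sym (lookup-++ʳ xs ys i)) ([]=⇒lookup h))

∣p++q∣≡∣p∣+∣q∣ : (p : Subset n) (q : Subset m) → ∣ p ++ q ∣ ≡ ∣ p ∣ + ∣ q ∣
∣p++q∣≡∣p∣+∣q∣ []            q = refl
∣p++q∣≡∣p∣+∣q∣ (inside  ∷ p) q = cong suc (∣p++q∣≡∣p∣+∣q∣ p q)
∣p++q∣≡∣p∣+∣q∣ (outside ∷ p) q = ∣p++q∣≡∣p∣+∣q∣ p q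

layer : Bool → Subset m → Subset m
layer inside  q = q
layer outside q = ⊥

-- p ⊠ q is the product set p × q, with vertex (a, b) encoded as combine a b as in BoxAdj.
_⊠_ : Subset n → Subset m → Subset (n * m)
[]      ⊠ q = []
(x ∷ p) ⊠ q = layer x q ++ p ⊠ q

∣p⊠q∣≡∣p∣*∣q∣ : (p : Subset n) (q : Subset m) → ∣ p ⊠ q ∣ ≡ ∣ p ∣ * ∣ q ∣
∣p⊠q∣≡∣p∣*∣q∣ []            q = refl
∣p⊠q∣≡∣p∣*∣q∣ (inside  ∷ p) q = trans (∣p++q∣≡∣p∣+∣q∣ q (p ⊠ q)) (cong (∣ q ∣ +_) (∣p⊠q∣≡∣p∣*∣q∣ p q))
∣p⊠q∣≡∣p∣*∣q∣ {m = m} (outside ∷ p) q =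
  trans (∣p++q∣≡∣p∣+∣q∣ (⊥ {m}) (p ⊠ q)) (cong₂ _+_ (∣⊥∣≡0 m) (∣p⊠q∣≡∣p∣*∣q∣ p q))

∈-⊠⁺ : {p : Subset n} {q : Subset m} {a : Fin n} {b : Fin m} → a ∈ p → b ∈ q → combine a b ∈ p ⊠ q
∈-⊠⁺ {p = inside ∷ p} {q} here        b∈q = []=-++⁺ˡ q (p ⊠ q) b∈q
∈-⊠⁺ {p = x ∷ p}      {q} (there a∈p) b∈q = []=-++⁺ʳ (layer x q) (p ⊠ q) (∈-⊠⁺ a∈p b∈q)

∈-⊠⁻ : (p : Subset n) (q : Subset m) (a : Fin n) (b : Fin m) → combine a b ∈ p ⊠ q → a ∈ p × b ∈ q
∈-⊠⁻ (inside  ∷ p) q zero    b ab∈ = here , []=-++⁻ˡ q (p ⊠ q) ab∈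
∈-⊠⁻ (outside ∷ p) q zero    b ab∈ = contradiction ([]=-++⁻ˡ ⊥ (p ⊠ q) ab∈) ∉⊥
∈-⊠⁻ (x       ∷ p) q (suc a) b ab∈ = map₁ there (∈-⊠⁻ p q a b ([]=-++⁻ʳ (layer x q) (p ⊠ q) ab∈))

_◅◅_ : ∀ {Adj : Fin n → Fin n → Set} {S u v w} → WalkIn Adj S u v → WalkIn Adj S v w → WalkIn Adj S u w
here _       ◅◅ q = q
step u∈ u~ p ◅◅ q = step u∈ u~ (p ◅◅ q)

ForcingClosed : (Fin n → Fin n → Set) → (Fin n → Set) → Set
ForcingClosed {n} Adj P = ∀ {v w : Fin n} → P v → Adj v w → (∀ x → Adj v x → x ≢ w → P x) → P w

module _ {AG : Fin n → Fin n → Set} {AH : Fin m → Fin m → Set} where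
  private
    _~_ : Fin (n * m) → Fin (n * m) → Set
    _~_ = BoxAdj AG AH

  □-row : ∀ {a x} b → AG a x → combine a b ~ combine x b
  □-row {a} {x} b a~x = a , b , x , b , refl , refl , inj₂ (refl , a~x)

  □-col : ∀ a {b y} → AH b y → combine a b ~ combine a y
  □-col a {b} {y} b~y = a , b , a , y , refl , refl , inj₁ (refl , b~y)

  walk-row : ∀ {p : Subset n} {q : Subset m} {a x b} → b ∈ q →
             WalkIn AG p a x → WalkIn _~_ (p ⊠ q) (combine a b) (combine x b)
  walk-row b∈q (here a∈p)      = here (∈-⊠⁺ a∈p b∈q)
  walk-row b∈q (step a∈p a~ w) = step (∈-⊠⁺ a∈p b∈q) (□-row _ a~) (walk-row b∈q w)

  walk-col : ∀ {p : Subset n} {q : Subset m} {a b y} → a ∈ p →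
             WalkIn AH q b y → WalkIn _~_ (p ⊠ q) (combine a b) (combine a y)
  walk-col a∈p (here b∈q)      = here (∈-⊠⁺ a∈p b∈q)
  walk-col a∈p (step b∈q b~ w) = step (∈-⊠⁺ a∈p b∈q) (□-col _ b~) (walk-col a∈p w)

  ⊠-connected : ∀ {p : Subset n} {q : Subset m} →
                InducedConnected AG p → InducedConnected AH q → InducedConnected _~_ (p ⊠ q)
  ⊠-connected {p} {q} p-conn q-conn = ∀-combine λ a b → ∀-combine λ x y ab∈ xy∈ →
    let a∈p , b∈q = ∈-⊠⁻ p q a b ab∈
        x∈p , y∈q = ∈-⊠⁻ p q x y xy∈
    in walk-row b∈q (p-conn a x a∈p x∈p) ◅◅ walk-col x∈p (q-conn b y b∈q y∈q)

  dominating-⊠-observes-layer : ∀ {p : Subset n} {q : Subset m} {b} → Dominating AG p → b ∈ q →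
                                ∀ a → Observed _~_ (p ⊠ q) (combine a b)
  dominating-⊠-observes-layer dom b∈q a with dom a
  ... | inj₁ a∈p              = self (∈-⊠⁺ a∈p b∈q)
  ... | inj₂ (x , x∈p , x~a)  = nbr (∈-⊠⁺ x∈p b∈q) (□-row _ x~a)

  -- The neighbours of (a, b) are (a, y) for y ~ b and vertices of the layer of b itself.
  observed-layers-forcingClosed : ∀ {T} → ForcingClosed AH (λ b → ∀ a → Observed _~_ T (combine a b))
  observed-layers-forcingClosed {T} {b} {b′} layer-b b~b′ others a =
    force (layer-b a) (□-col a b~b′) nbr-observed
    where
    nbr-observed : ∀ u → combine a b ~ u → u ≢ combine a b′ → Observed _~_ T u
    nbr-observed _ (a₀ , b₀ , x , y , ab≡ , refl , adj) u≢ with combine-injective a b a₀ b₀ ab≡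
    nbr-observed _ (a₀ , b₀ , x , y , ab≡ , refl , inj₁ (refl , b~y)) u≢ | refl , refl =
      others y b~y (λ { refl → u≢ refl }) x
    nbr-observed _ (a₀ , b₀ , x , y , ab≡ , refl , inj₂ (refl , _))   u≢ | refl , refl = layer-b x

cycleAdj⇒≤⊎≡suc : ∀ {b y : Fin m} → 0 < toℕ b → CycleAdj m b y → toℕ y ≤ toℕ b ⊎ toℕ y ≡ suc (toℕ b)
cycleAdj⇒≤⊎≡suc         _   (inj₁ (inj₁ y≡1+b))     = inj₂ y≡1+b
cycleAdj⇒≤⊎≡suc {b = b} _   (inj₁ (inj₂ (_ , y≡0))) = inj₁ (subst (_≤ toℕ b) (sym y≡0) z≤n)
cycleAdj⇒≤⊎≡suc {y = y} _   (inj₂ (inj₁ b≡1+y))     = inj₁ (≤-trans (n≤1+n (toℕ y)) (≤-reflexive (sym b≡1+y)))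
cycleAdj⇒≤⊎≡suc         0<b (inj₂ (inj₂ (_ , b≡0))) = contradiction (subst (0 <_) b≡0 0<b) λ ()

edge₀₁ : Subset (2 + m)
edge₀₁ = inside ∷ inside ∷ ⊥

edge₀₁-connected : InducedConnected (CycleAdj (2 + m)) edge₀₁
edge₀₁-connected zero          zero          _ _ = here here
edge₀₁-connected (suc zero)    (suc zero)    _ _ = here (there here)
edge₀₁-connected zero          (suc zero)    _ _ = step here (inj₁ (inj₁ refl)) (here (there here))
edge₀₁-connected (suc zero)    zero          _ _ = step (there here) (inj₂ (inj₁ refl)) (here here)
edge₀₁-connected (suc (suc u)) _ (there (there u∈⊥)) _ = contradiction u∈⊥ ∉⊥
edge₀₁-connected _ (suc (suc v)) _ (there (there v∈⊥)) = contradiction v∈⊥ ∉⊥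

cycle-forcing : (P : Fin (2 + m) → Set) → ForcingClosed (CycleAdj (2 + m)) P →
                P zero → P (suc zero) → ∀ c → P c
cycle-forcing {m} P closed P₀ P₁ c = upTo (toℕ c) c (n≤1+n (toℕ c))
  where
  upTo : ∀ k c → toℕ c ≤ suc k → P c
  upTo zero    zero          _         = P₀
  upTo zero    (suc zero)    _         = P₁
  upTo zero    (suc (suc _)) (s≤s ())
  upTo (suc k) c             c≤2+k with m≤n⇒m<n∨m≡n c≤2+k
  ... | inj₁ c<2+k = upTo k c (s≤s⁻¹ c<2+k)
  ... | inj₂ c≡2+k = closed (upTo k b (≤-reflexive b≡1+k)) (inj₁ (inj₁ (trans c≡2+k (cong suc (sym b≡1+k))))) others
    where
    1+k<2+m : suc k < 2 + m
    1+k<2+m = <⇒≤ (subst (_< 2 + m) c≡2+k (toℕ<n c))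
    b : Fin (2 + m)
    b = fromℕ< 1+k<2+m
    b≡1+k : toℕ b ≡ suc k
    b≡1+k = toℕ-fromℕ< 1+k<2+m
    others : ∀ y → CycleAdj (2 + m) b y → y ≢ c → P y
    others y b~y y≢c with cycleAdj⇒≤⊎≡suc (subst (0 <_) (sym b≡1+k) (s≤s z≤n)) b~y
    ... | inj₁ y≤b    = upTo k y (≤-trans y≤b (≤-reflexive b≡1+k))
    ... | inj₂ y≡1+b  = contradiction (toℕ-injective (trans y≡1+b (trans (cong suc b≡1+k) (sym c≡2+k)))) y≢c

dominating-⊠-edge₀₁-powerDominating : ∀ {Adj : Fin n → Fin n → Set} {p : Subset n} → Dominating Adj p →
                                      IsPowerDominating (BoxAdj Adj (CycleAdj (2 + m))) (p ⊠ edge₀₁)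
dominating-⊠-edge₀₁-powerDominating dom = ∀-combine λ a c →
  cycle-forcing _ observed-layers-forcingClosed
    (dominating-⊠-observes-layer dom here) (dominating-⊠-observes-layer dom (there here)) c a

connDom-⊠-edge₀₁-connPowerDom : ∀ {Adj : Fin n → Fin n → Set} {p : Subset n} → IsConnectedDominating Adj p →
                                IsConnectedPowerDominating (BoxAdj Adj (CycleAdj (2 + m))) (p ⊠ edge₀₁)
connDom-⊠-edge₀₁-connPowerDom (dom , conn) =
  dominating-⊠-edge₀₁-powerDominating dom , ⊠-connected conn edge₀₁-connected

∣p⊠edge₀₁∣≡2*∣p∣ : (p : Subset n) → ∣ p ⊠ edge₀₁ {m} ∣ ≡ 2 * ∣ p ∣
∣p⊠edge₀₁∣≡2*∣p∣ {m = m} p =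
  trans (∣p⊠q∣≡∣p∣*∣q∣ p edge₀₁) (trans (cong (λ e → ∣ p ∣ * (2 + e)) (∣⊥∣≡0 m)) (*-comm ∣ p ∣ 2))

corollary3 : (N : ℕ) (Adj : Fin N → Fin N → Set) → IsSimple Adj → Connected Adj → 3 ≤ N →
             (m : ℕ) → 3 ≤ m →
             (k : ℕ) → ConnDomNumber Adj k →
             (k′ : ℕ) → ConnPowerDomNumber (BoxAdj Adj (CycleAdj m)) k′ →
             k′ ≤ 2 * k
corollary3 _ _ _ _ _ (suc (suc _)) (s≤s (s≤s _)) _ ((S , S-connDom , refl) , _) k′ (_ , k′-minimal) =
  subst (k′ ≤_) (∣p⊠edge₀₁∣≡2*∣p∣ S) (k′-minimal (S ⊠ edge₀₁) (connDom-⊠-edge₀₁-connPowerDom S-connDom))
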